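{- Let $G$ be a 2-connected graph having a totally odd cycle basis. Then any two odd cycles of $G$ have an odd number of common edges.
   Context: Graphs are finite, may have parallel edges but no loops. A circuit is a connected 2-regular graph; a cycle is an edge-disjoint union of circuits, and it is odd if it has an odd number of edges. The cycle space $\mathcal{C}(G)\subseteq\mathbb{F}_2^{E(G)}$ is the space of incidence vectors of cycles; a cycle basis is a set of cycles whose incidence vectors form a basis of $\mathcal{C}(G)$ over $\mathbb{F}_2$. A cycle basis is odd if all its elements are odd, and an odd cycle basis is totally odd if any two of its elements share an odd number of edges. -}

module Defs where

open import Data.Nat using (ℕ; zero; suc; _+_; _<_)
open import Data.Nat.DivMod using (_%_)
open import Data.Bool using (Bool; true; false; _∧_; _∨_; _xor_; if_then_else_; T)
open import Data.Fin using (Fin; _≟_)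
import Data.Fin
open import Data.List using (List; []; _∷_; map; foldr)
open import Data.Nat.ListAction using (sum)
open import Data.List.Relation.Unary.AllPairs using (AllPairs)
open import Data.List.Relation.Unary.All using (All)
open import Data.Product using (Σ; _×_; _,_; proj₁; proj₂; ∃)
open import Data.Sum using (_⊎_)
open import Relation.Nullary using (¬_)
open import Relation.Nullary.Decidable using (⌊_⌋)
open import Relation.Binary.PropositionalEquality using (_≡_; _≢_)

Odd : ℕ → Set
Odd k = k % 2 ≡ 1

-- Finite loopless multigraph: vertices Fin n, edges Fin m, each edge has two
-- distinct end vertices (parallel edges allowed).
record Graph : Set where
  field
    n : ℕ
    m : ℕ
    ends : Fin m → Fin n × Fin n
    loopless : ∀ e → proj₁ (ends e) ≢ proj₂ (ends e)
open Graph public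

-- Edge sets = incidence vectors over F₂ (true = 1).
EdgeSet : Graph → Set
EdgeSet G = Fin (m G) → Bool

allFinL : (k : ℕ) → List (Fin k)
allFinL zero = []
allFinL (suc k) = Data.Fin.zero ∷ map Data.Fin.suc (allFinL k)

size : (G : Graph) → EdgeSet G → ℕ
size G C = sum (map (λ e → if C e then 1 else 0) (allFinL (m G)))

common : (G : Graph) → EdgeSet G → EdgeSet G → ℕ
common G C D = size G (λ e → C e ∧ D e)

incident : (G : Graph) → Fin (n G) → Fin (m G) → Bool
incident G v e = ⌊ v ≟ proj₁ (ends G e) ⌋ ∨ ⌊ v ≟ proj₂ (ends G e) ⌋

degree : (G : Graph) → EdgeSet G → Fin (n G) → ℕ
degree G C v = size G (λ e → C e ∧ incident G v e)

-- walks from u to v using only edges satisfying Q and vertices satisfying P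
-- (the vertices after the start must satisfy P)
data Walk (G : Graph) (P : Fin (n G) → Set) (Q : Fin (m G) → Set)
          : Fin (n G) → Fin (n G) → Set where
  here : ∀ {u} → Walk G P Q u u
  step : ∀ {u w v} (e : Fin (m G)) → Q e →
         ((ends G e ≡ (u , w)) ⊎ (ends G e ≡ (w , u))) → P w →
         Walk G P Q w v → Walk G P Q u v

ConnectedOn : (G : Graph) → (Fin (n G) → Set) → Set
ConnectedOn G P = ∀ u v → P u → P v → Walk G P (λ _ → Data.Unit.⊤) u v
  where import Data.Unit

TwoConnected : Graph → Set
TwoConnected G =
  2 < n G × ConnectedOn G (λ _ → Data.Unit.⊤) ×
  (∀ x → ConnectedOn G (λ v → v ≢ x))
  where import Data.Unit

Circuit : (G : Graph) → EdgeSet G → Set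
Circuit G C =
  (∃ λ e → T (C e)) ×
  (∀ v → degree G C v ≡ 0 ⊎ degree G C v ≡ 2) ×
  (∀ u v → ¬ degree G C u ≡ 0 → ¬ degree G C v ≡ 0 →
     Walk G (λ w → ¬ degree G C w ≡ 0) (λ e → T (C e)) u v)

Disjoint : (G : Graph) → EdgeSet G → EdgeSet G → Set
Disjoint G C D = ∀ e → T (C e ∧ D e) → Data.Empty.⊥
  where import Data.Empty

emptySet : (G : Graph) → EdgeSet G
emptySet G _ = false

unionL : (G : Graph) → List (EdgeSet G) → EdgeSet G
unionL G Cs e = foldr (λ C b → C e ∨ b) false Cs

sumL : (G : Graph) → List (EdgeSet G) → EdgeSet G
sumL G Cs e = foldr (λ C b → C e xor b) false Cs

Cycle : (G : Graph) → EdgeSet G → Set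
Cycle G C = Σ (List (EdgeSet G)) λ Cs →
  All (Circuit G) Cs × AllPairs (Disjoint G) Cs × (∀ e → C e ≡ unionL G Cs e)

OddCycle : (G : Graph) → EdgeSet G → Set
OddCycle G C = Cycle G C × Odd (size G C)

InCycleSpace : (G : Graph) → EdgeSet G → Set
InCycleSpace G x = Σ (List (EdgeSet G)) λ Cs →
  All (Cycle G) Cs × (∀ e → x e ≡ sumL G Cs e)

combo : (G : Graph) {k : ℕ} → (Fin k → EdgeSet G) → (Fin k → Bool) → EdgeSet G
combo G {k} B S e = foldr (λ i b → (S i ∧ B i e) xor b) false (allFinL k)

CycleBasis : (G : Graph) {k : ℕ} → (Fin k → EdgeSet G) → Set
CycleBasis G {k} B =
  (∀ i → Cycle G (B i)) ×
  (∀ S → (∀ e → combo G B S e ≡ false) → ∀ i → S i ≡ false) ×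
  (∀ x → InCycleSpace G x → Σ (Fin k → Bool) λ S → ∀ e → x e ≡ combo G B S e)

TotallyOddCycleBasis : (G : Graph) {k : ℕ} → (Fin k → EdgeSet G) → Set
TotallyOddCycleBasis G {k} B =
  CycleBasis G B ×
  (∀ i → Odd (size G (B i))) ×
  (∀ i j → i ≢ j → Odd (common G (B i) (B j)))

HasTotallyOddCycleBasis : Graph → Set
HasTotallyOddCycleBasis G =
  Σ ℕ λ k → Σ (Fin k → EdgeSet G) λ B → TotallyOddCycleBasis G B

module Submission where

-- Over F₂ the number of common edges mod 2 is a symmetric bilinear form ⟨_,_⟩
-- on edge sets, and a set x is odd iff ⟨ x , x ⟩ = 1.  If B is a totally odd
-- cycle basis then ⟨ Bᵢ , Bⱼ ⟩ = 1 for all i, j, so for x = Σ Sᵢ Bᵢ and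
-- y = Σ Tⱼ Bⱼ bilinearity gives ⟨ x , y ⟩ = (Σ Sᵢ)(Σ Tⱼ).  Taking y = x shows
-- Σ Sᵢ = 1 for every odd cycle x.

open import Defs
open import Data.Nat using (ℕ; _+_)
open import Data.Nat.DivMod using (_%_; %-distribˡ-+)
open import Data.Nat.ListAction using (sum)
open import Data.Bool using (Bool; true; false; _∧_; _xor_; if_then_else_)
open import Data.Bool.Properties
  using (∧-comm; ∧-assoc; ∧-idem; ∧-identityʳ; ∧-zeroʳ; ∧-distribˡ-xor;
         xor-identityʳ; xor-∧-commutativeRing)
open import Data.Fin using (Fin; _≟_)
open import Data.List using (List; []; _∷_; map; foldr)
open import Data.List.Relation.Unary.All using ([]; _∷_)
open import Data.Product using (Σ; _,_)
open import Algebra.Bundles using (CommutativeRing)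
open import Algebra.Properties.CommutativeSemigroup
  (CommutativeRing.+-commutativeSemigroup xor-∧-commutativeRing) using (interchange)
open import Relation.Nullary using (yes; no)
open import Relation.Binary.PropositionalEquality
open ≡-Reasoning

xorSum : {A : Set} → List A → (A → Bool) → Bool
xorSum L f = foldr (λ a b → f a xor b) false L

module _ {A : Set} where

  xorSum-cong : (L : List A) {f g : A → Bool} → (∀ a → f a ≡ g a) →
                xorSum L f ≡ xorSum L g
  xorSum-cong []      f≗g = refl
  xorSum-cong (a ∷ L) f≗g = cong₂ _xor_ (f≗g a) (xorSum-cong L f≗g)

  xorSum-false : (L : List A) → xorSum L (λ _ → false) ≡ false
  xorSum-false []      = refl
  xorSum-false (_ ∷ L) = xorSum-false L

  xorSum-xor : (L : List A) (f g : A → Bool) →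
               xorSum L (λ a → f a xor g a) ≡ xorSum L f xor xorSum L g
  xorSum-xor []      f g = refl
  xorSum-xor (a ∷ L) f g = begin
    (f a xor g a) xor xorSum L (λ a → f a xor g a)
      ≡⟨ cong ((f a xor g a) xor_) (xorSum-xor L f g) ⟩
    (f a xor g a) xor (xorSum L f xor xorSum L g)
      ≡⟨ interchange (f a) (g a) (xorSum L f) (xorSum L g) ⟩
    (f a xor xorSum L f) xor (g a xor xorSum L g) ∎

  xorSum-∧ˡ : (L : List A) (c : Bool) (f : A → Bool) →
              xorSum L (λ a → c ∧ f a) ≡ c ∧ xorSum L f
  xorSum-∧ˡ []      c f = sym (∧-zeroʳ c)
  xorSum-∧ˡ (a ∷ L) c f = begin
    (c ∧ f a) xor xorSum L (λ a → c ∧ f a) ≡⟨ cong ((c ∧ f a) xor_) (xorSum-∧ˡ L c f) ⟩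
    (c ∧ f a) xor (c ∧ xorSum L f)         ≡⟨ ∧-distribˡ-xor c (f a) (xorSum L f) ⟨
    c ∧ (f a xor xorSum L f)               ∎

  xorSum-∧ʳ : (L : List A) (c : Bool) (f : A → Bool) →
              xorSum L (λ a → f a ∧ c) ≡ xorSum L f ∧ c
  xorSum-∧ʳ L c f = begin
    xorSum L (λ a → f a ∧ c) ≡⟨ xorSum-cong L (λ a → ∧-comm (f a) c) ⟩
    xorSum L (λ a → c ∧ f a) ≡⟨ xorSum-∧ˡ L c f ⟩
    c ∧ xorSum L f           ≡⟨ ∧-comm c (xorSum L f) ⟩
    xorSum L f ∧ c           ∎

  count-%2 : (L : List A) (f : A → Bool) →
             sum (map (λ a → if f a then 1 else 0) L) % 2 ≡ (if xorSum L f then 1 else 0)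
  count-%2 []      f = refl
  count-%2 (a ∷ L) f = begin
    (indicator (f a) + rest) % 2
      ≡⟨ %-distribˡ-+ (indicator (f a)) rest 2 ⟩
    (indicator (f a) % 2 + rest % 2) % 2
      ≡⟨ cong (λ r → (indicator (f a) % 2 + r) % 2) (count-%2 L f) ⟩
    (indicator (f a) % 2 + indicator (xorSum L f)) % 2
      ≡⟨ indicator-xor (f a) (xorSum L f) ⟩
    indicator (f a xor xorSum L f) ∎
    where
    indicator : Bool → ℕ
    indicator b = if b then 1 else 0
    rest : ℕ
    rest = sum (map (λ a → indicator (f a)) L)
    indicator-xor : ∀ b c →
      (indicator b % 2 + indicator c) % 2 ≡ indicator (b xor c)
    indicator-xor false false = refl
    indicator-xor false true  = refl
    indicator-xor true  false = refl
    indicator-xor true  true  = refl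

  odd-count⇒xorSum : (L : List A) (f : A → Bool) →
                     Odd (sum (map (λ a → if f a then 1 else 0) L)) → xorSum L f ≡ true
  odd-count⇒xorSum L f odd with xorSum L f | count-%2 L f
  ... | true  | _    = refl
  ... | false | even with () ← trans (sym even) odd

  xorSum⇒odd-count : (L : List A) (f : A → Bool) →
                     xorSum L f ≡ true → Odd (sum (map (λ a → if f a then 1 else 0) L))
  xorSum⇒odd-count L f sum≡true = trans (count-%2 L f) (cong (λ b → if b then 1 else 0) sum≡true)

xorSum-swap : {A B : Set} (L : List A) (M : List B) (h : A → B → Bool) →
              xorSum L (λ a → xorSum M (h a)) ≡ xorSum M (λ b → xorSum L (λ a → h a b))
xorSum-swap []      M h = sym (xorSum-false M)
xorSum-swap (a ∷ L) M h = begin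
  xorSum M (h a) xor xorSum L (λ a → xorSum M (h a))
    ≡⟨ cong (xorSum M (h a) xor_) (xorSum-swap L M h) ⟩
  xorSum M (h a) xor xorSum M (λ b → xorSum L (λ a → h a b))
    ≡⟨ xorSum-xor M (h a) (λ b → xorSum L (λ a → h a b)) ⟨
  xorSum M (λ b → h a b xor xorSum L (λ a → h a b)) ∎

module Pairing (G : Graph) where

  private
    E : List (Fin (m G))
    E = allFinL (m G)

  ⟨_,_⟩ : EdgeSet G → EdgeSet G → Bool
  ⟨ x , y ⟩ = xorSum E (λ e → x e ∧ y e)

  odd-common⇒⟨⟩≡true : ∀ x y → Odd (common G x y) → ⟨ x , y ⟩ ≡ true
  odd-common⇒⟨⟩≡true x y = odd-count⇒xorSum E (λ e → x e ∧ y e)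

  ⟨⟩≡true⇒odd-common : ∀ x y → ⟨ x , y ⟩ ≡ true → Odd (common G x y)
  ⟨⟩≡true⇒odd-common x y = xorSum⇒odd-count E (λ e → x e ∧ y e)

  odd-size⇒⟨⟩≡true : ∀ x → Odd (size G x) → ⟨ x , x ⟩ ≡ true
  odd-size⇒⟨⟩≡true x odd =
    trans (xorSum-cong E (λ e → ∧-idem (x e))) (odd-count⇒xorSum E x odd)

  ⟨⟩-cong : ∀ {x x′ y y′} → (∀ e → x e ≡ x′ e) → (∀ e → y e ≡ y′ e) →
            ⟨ x , y ⟩ ≡ ⟨ x′ , y′ ⟩
  ⟨⟩-cong x≗x′ y≗y′ = xorSum-cong E (λ e → cong₂ _∧_ (x≗x′ e) (y≗y′ e))

  ⟨⟩-comm : ∀ x y → ⟨ x , y ⟩ ≡ ⟨ y , x ⟩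
  ⟨⟩-comm x y = xorSum-cong E (λ e → ∧-comm (x e) (y e))

  module _ {k : ℕ} (B : Fin k → EdgeSet G) where

    private
      I : List (Fin k)
      I = allFinL k

    ⟨combo,⟩ : ∀ S y → ⟨ combo G B S , y ⟩ ≡ xorSum I (λ i → S i ∧ ⟨ B i , y ⟩)
    ⟨combo,⟩ S y = begin
      xorSum E (λ e → xorSum I (λ i → S i ∧ B i e) ∧ y e)
        ≡⟨ xorSum-cong E (λ e → xorSum-∧ʳ I (y e) (λ i → S i ∧ B i e)) ⟨
      xorSum E (λ e → xorSum I (λ i → (S i ∧ B i e) ∧ y e))
        ≡⟨ xorSum-swap E I (λ e i → (S i ∧ B i e) ∧ y e) ⟩
      xorSum I (λ i → xorSum E (λ e → (S i ∧ B i e) ∧ y e))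
        ≡⟨ xorSum-cong I (λ i → xorSum-cong E (λ e → ∧-assoc (S i) (B i e) (y e))) ⟩
      xorSum I (λ i → xorSum E (λ e → S i ∧ (B i e ∧ y e)))
        ≡⟨ xorSum-cong I (λ i → xorSum-∧ˡ E (S i) (λ e → B i e ∧ y e)) ⟩
      xorSum I (λ i → S i ∧ ⟨ B i , y ⟩) ∎

    module _ (allOne : ∀ i j → ⟨ B i , B j ⟩ ≡ true) where

      ⟨combo,combo⟩ : ∀ S T → ⟨ combo G B S , combo G B T ⟩ ≡ xorSum I S ∧ xorSum I T
      ⟨combo,combo⟩ S T = begin
        ⟨ combo G B S , combo G B T ⟩                 ≡⟨ ⟨combo,⟩ S (combo G B T) ⟩
        xorSum I (λ i → S i ∧ ⟨ B i , combo G B T ⟩) ≡⟨ xorSum-cong I (λ i → cong (S i ∧_) (⟨B,combo⟩ i)) ⟩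
        xorSum I (λ i → S i ∧ xorSum I T)            ≡⟨ xorSum-∧ʳ I (xorSum I T) S ⟩
        xorSum I S ∧ xorSum I T                      ∎
        where
        ⟨B,combo⟩ : ∀ i → ⟨ B i , combo G B T ⟩ ≡ xorSum I T
        ⟨B,combo⟩ i = begin
          ⟨ B i , combo G B T ⟩                 ≡⟨ ⟨⟩-comm (B i) (combo G B T) ⟩
          ⟨ combo G B T , B i ⟩                 ≡⟨ ⟨combo,⟩ T (B i) ⟩
          xorSum I (λ j → T j ∧ ⟨ B j , B i ⟩) ≡⟨ xorSum-cong I (λ j → cong (T j ∧_) (allOne j i)) ⟩
          xorSum I (λ j → T j ∧ true)          ≡⟨ xorSum-cong I (λ j → ∧-identityʳ (T j)) ⟩
          xorSum I T                           ∎

      odd⇒odd-coordinates : ∀ {x} S → (∀ e → x e ≡ combo G B S e) →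
                            Odd (size G x) → xorSum I S ≡ true
      odd⇒odd-coordinates {x} S x≗BS odd = begin
        xorSum I S                    ≡⟨ ∧-idem (xorSum I S) ⟨
        xorSum I S ∧ xorSum I S       ≡⟨ ⟨combo,combo⟩ S S ⟨
        ⟨ combo G B S , combo G B S ⟩ ≡⟨ ⟨⟩-cong x≗BS x≗BS ⟨
        ⟨ x , x ⟩                     ≡⟨ odd-size⇒⟨⟩≡true x odd ⟩
        true                          ∎

      odd-elements-pair-to-one : ∀ {x y} S T →
        (∀ e → x e ≡ combo G B S e) → (∀ e → y e ≡ combo G B T e) →
        Odd (size G x) → Odd (size G y) → ⟨ x , y ⟩ ≡ true
      odd-elements-pair-to-one {x} {y} S T x≗BS y≗BT oddx oddy = begin
        ⟨ x , y ⟩                     ≡⟨ ⟨⟩-cong x≗BS y≗BT ⟩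
        ⟨ combo G B S , combo G B T ⟩ ≡⟨ ⟨combo,combo⟩ S T ⟩
        xorSum I S ∧ xorSum I T       ≡⟨ cong₂ _∧_ (odd⇒odd-coordinates S x≗BS oddx)
                                                   (odd⇒odd-coordinates T y≗BT oddy) ⟩
        true                          ∎

    totallyOdd⇒⟨B,B⟩≡true : TotallyOddCycleBasis G B → ∀ i j → ⟨ B i , B j ⟩ ≡ true
    totallyOdd⇒⟨B,B⟩≡true (_ , oddB , oddBB) i j with i ≟ j
    ... | yes refl = odd-size⇒⟨⟩≡true (B i) (oddB i)
    ... | no  i≢j  = odd-common⇒⟨⟩≡true (B i) (B j) (oddBB i j i≢j)

cycle-coordinates : ∀ {G k} {B : Fin k → EdgeSet G} → CycleBasis G B →
                    ∀ {x} → Cycle G x → Σ (Fin k → Bool) λ S → ∀ e → x e ≡ combo G B S e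
cycle-coordinates (_ , _ , spans) {x} cyc =
  spans x (x ∷ [] , cyc ∷ [] , λ e → sym (xor-identityʳ (x e)))

lemma2p5 : (G : Graph) → TwoConnected G → HasTotallyOddCycleBasis G →
    ∀ C D → OddCycle G C → OddCycle G D → Odd (common G C D)
lemma2p5 G _ (k , B , totallyOdd@(basis , _)) C D (cycC , oddC) (cycD , oddD)
  with cycle-coordinates basis cycC | cycle-coordinates basis cycD
... | S , C≗BS | T , D≗BT =
  ⟨⟩≡true⇒odd-common C D
    (odd-elements-pair-to-one B (totallyOdd⇒⟨B,B⟩≡true B totallyOdd) S T C≗BS D≗BT oddC oddD)
  where open Pairing G
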